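{- Let $(\mathbb S,+,\Box,\partial)$ be a monotonic arithmetical semiring and let $p$ be the smallest integer such that $\mathbb S^\Box(p)\neq0$. Then \[ \mathbb S^+(n)-\mathbb S^\Box(n)\le \mathbb S^\Box(p)\,\mathbb S\left(\left\lfloor\frac np\right\rfloor\right)+\mathbb S\left(\left\lfloor\frac n{p+1}\right\rfloor+p+1\right) \] for all sufficiently large $n$. Moreover, if axiom $\mathcal G_1^+$ holds, then \[ \mathbb S^+(pn)-\mathbb S^\Box(pn)=\mathbb S^\Box(p)\,\mathbb S^+(n)+o\left(\mathbb S^+\left(\left\lfloor\frac{pn}{p+1}\right\rfloor+p+1\right)\right). \]
   Context: An arithmetical semiring is a tuple $(\mathbb S,+,\Box,\partial)$ where: $(\mathbb S,+)$ is a commutative monoid with identity $\mathbf e_+$ which is free on a set $\mathbb S^+\subseteq\mathbb S\setminus\{\mathbf e_+\}$ (additive primes); $\Box$ is a commutative associative operation distributive over $+$ making $\mathbb S\setminus\{\mathbf e_+\}$ a commutative monoid with identity $\mathbf e_\Box$; $\partial:\mathbb S\to\mathbb R_{\ge0}$ satisfies $\partial(A+B)=\partial(A)+\partial(B)$ and $\partial(A\Box B)=\partial(A)\partial(B)$; $\partial^{ -1}(0)=\{\mathbf e_+\}$; each $\partial^{ -1}(x)$ is finite and is empty unless $x$ is an integer; $(\mathbb S^+,\Box)$ is a free commutative monoid with identity $\mathbf e_\Box$ on a set $\mathbb S^\Box\subseteq\mathbb S^+\setminus\{\mathbf e_\Box\}$ (multiplicative primes); and $\mathbf e_\Box$ is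 the only additive prime of degree $1$. $\mathbb S(n)$, $\mathbb S^+(n)$, $\mathbb S^\Box(n)$ denote the numbers of elements of $\mathbb S$, $\mathbb S^+$, $\mathbb S^\Box$ of degree $n$. Monotonic: there is $N$ with $\mathbb S^+(n)\le\mathbb S^+(n+1)$ for all $n\ge N$. Axiom $\mathcal G_1^+$: $\mathbb S(n)-\mathbb S^+(n)=o(\mathbb S(n))$. The $o$-term in the second display denotes a sequence $E(n)$ with $|E(n)|\le\epsilon\,\mathbb S^+(\lfloor pn/(p+1)\rfloor+p+1)$ for every $\epsilon>0$ and all sufficiently large $n$. -}

module Defs where

open import Data.Nat using (ℕ; zero; suc; _+_; _*_; _≤_; _<_; _≥_)
open import Data.List using (List; []; _∷_; foldr; length)
open import Data.List.Membership.Propositional using (_∈_)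
open import Data.List.Relation.Unary.Unique.Propositional using (Unique)
open import Data.List.Relation.Binary.Permutation.Propositional using (_↭_)
open import Data.Product using (Σ; ∃; _×_)
open import Relation.Binary.PropositionalEquality using (_≡_; _≢_)
open import Relation.Nullary using (¬_)

-- Conventions:
--  * equality on the carrier is propositional equality;
--  * ∂ takes values in ℕ (the axioms force ∂ to be integer valued and ≥ 0);
--  * "each fibre ∂⁻¹(n) is finite" is given constructively by an explicit
--    duplicate-free list  level n  of exactly the elements of degree n;
--  * the sets of additive primes S⁺ and multiplicative primes S^□ are given by
--    explicit duplicate-free lists of their elements of each degree n
--    (these are finite, being subsets of the finite fibres).
record ArithSemiring : Set₁ where
  infixl 6 _⊕_
  infixl 7 _□_
  field
    S   : Set
    _⊕_ : S → S → S
    _□_ : S → S → S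
    e₊  : S
    e□  : S
    ∂   : S → ℕ

    level        : ℕ → List S
    level-unique : ∀ n → Unique (level n)
    level-sound  : ∀ n A → A ∈ level n → ∂ A ≡ n
    level-comp   : ∀ A → A ∈ level (∂ A)

    addPrimes        : ℕ → List S
    addPrimes-unique : ∀ n → Unique (addPrimes n)
    addPrimes-sound  : ∀ n A → A ∈ addPrimes n → ∂ A ≡ n

    mulPrimes        : ℕ → List S
    mulPrimes-unique : ∀ n → Unique (mulPrimes n)
    mulPrimes-sound  : ∀ n A → A ∈ mulPrimes n → ∂ A ≡ n

  IsAddPrime : S → Set
  IsAddPrime A = A ∈ addPrimes (∂ A)

  IsMulPrime : S → Set
  IsMulPrime A = A ∈ mulPrimes (∂ A)

  sumL : List S → S
  sumL = foldr _⊕_ e₊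

  prodL : List S → S
  prodL = foldr _□_ e□

  field
    ⊕-assoc : ∀ A B C → (A ⊕ B) ⊕ C ≡ A ⊕ (B ⊕ C)
    ⊕-comm  : ∀ A B → A ⊕ B ≡ B ⊕ A
    ⊕-idˡ   : ∀ A → e₊ ⊕ A ≡ A
    addPrime-≢e₊ : ∀ A → IsAddPrime A → A ≢ e₊
    add-exists   : ∀ A → Σ (List S) λ xs →
                     ((∀ x → x ∈ xs → IsAddPrime x) × sumL xs ≡ A)
    add-unique   : ∀ xs ys → (∀ x → x ∈ xs → IsAddPrime x) →
                     (∀ y → y ∈ ys → IsAddPrime y) →
                     sumL xs ≡ sumL ys → xs ↭ ys

    □-assoc : ∀ A B C → (A □ B) □ C ≡ A □ (B □ C)
    □-comm  : ∀ A B → A □ B ≡ B □ A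
    □-distribˡ : ∀ A B C → A □ (B ⊕ C) ≡ (A □ B) ⊕ (A □ C)
    e□-≢e₊   : e□ ≢ e₊
    □-closed : ∀ A B → A ≢ e₊ → B ≢ e₊ → A □ B ≢ e₊
    □-idˡ    : ∀ A → A ≢ e₊ → e□ □ A ≡ A

    ∂-⊕ : ∀ A B → ∂ (A ⊕ B) ≡ ∂ A + ∂ B
    ∂-□ : ∀ A B → ∂ (A □ B) ≡ ∂ A * ∂ B
    ∂-zero   : ∂ e₊ ≡ 0
    ∂-zero⁻¹ : ∀ A → ∂ A ≡ 0 → A ≡ e₊

    e□-addPrime      : IsAddPrime e□
    addPrime-□       : ∀ A B → IsAddPrime A → IsAddPrime B → IsAddPrime (A □ B)
    mulPrime-addPrime : ∀ A → IsMulPrime A → IsAddPrime A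
    mulPrime-≢e□     : ∀ A → IsMulPrime A → A ≢ e□
    mul-exists : ∀ A → IsAddPrime A → Σ (List S) λ xs →
                   ((∀ x → x ∈ xs → IsMulPrime x) × prodL xs ≡ A)
    mul-unique : ∀ xs ys → (∀ x → x ∈ xs → IsMulPrime x) →
                   (∀ y → y ∈ ys → IsMulPrime y) →
                   prodL xs ≡ prodL ys → xs ↭ ys

    deg1-addPrime : ∀ A → IsAddPrime A → ∂ A ≡ 1 → A ≡ e□

  Sc : ℕ → ℕ
  Sc n = length (level n)

  S⁺ : ℕ → ℕ
  S⁺ n = length (addPrimes n)

  S□ : ℕ → ℕ
  S□ n = length (mulPrimes n)

  Monotonic : Set
  Monotonic = ∃ λ N → ∀ n → n ≥ N → S⁺ n ≤ S⁺ (suc n)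

  -- axiom G₁⁺ : S(n) − S⁺(n) = o(S(n)).  Since S⁺(n) ≤ S(n), this says:
  -- for every ε = 1/(k+1) > 0, eventually S(n) ≤ S⁺(n) + ε S(n).
  AxiomG₁⁺ : Set
  AxiomG₁⁺ = ∀ k → ∃ λ N → ∀ n → n ≥ N → suc k * Sc n ≤ suc k * S⁺ n + Sc n

  IsLeastMulDegree : ℕ → Set
  IsLeastMulDegree p = S□ p ≢ 0 × (∀ q → q < p → S□ q ≡ 0)

-- Both estimates count elements of fixed degree through injections. An additive prime A
-- of degree n is either a multiplicative prime, or A = P □ B with P a multiplicative prime
-- of the least degree p (so ∂ B = n / p), or A = P □ B with ∂ P, ∂ B > p. In the last case
-- ∂ P + ∂ B ≤ ∂ P ∂ B / (p + 1) + p + 1 = m, and A ↦ P + B + (m − ∂ P − ∂ B) e□ is injective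
-- by additive unique factorisation and lands in the non-primes of degree m; this gives the
-- first bound and, at degree p n, S⁺(pn) + S⁺(m) ≤ S□(pn) + S□(p) S⁺(n) + S(m).
-- Conversely a pair (P, B) with ∂ P = p, ∂ B = n goes to the additive prime P □ B unless B
-- itself splits off a factor of degree p, so S□(p) S⁺(n) + S□(pn) ≤ S⁺(pn) + S□(p)² S⁺(n/p).
-- Under G₁⁺ both S(m) − S⁺(m) and, since S(j) + S⁺(j+1) ≤ S(j+1), also S(n/p) are
-- negligible against S⁺(m), the latter by monotonicity of S⁺.

module Submission where

open import Defs

open import Algebra.Core using (Op₂)
open import Algebra.Structures using (IsCommutativeMonoid)
open import Data.Empty using (⊥; ⊥-elim)
open import Data.List using (List; []; _∷_; [_]; length; map; _++_; foldr; replicate; cartesianProduct)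
open import Data.List.Membership.Propositional using (_∈_; find)
open import Data.List.Membership.Propositional.Properties
  using (∈-map⁺; ∈-map⁻; ∈-++⁺ˡ; ∈-++⁺ʳ; ∈-∃++; ∈-cartesianProduct⁺; ∈-cartesianProduct⁻)
open import Data.List.Properties using (length-++; length-map)
open import Data.List.Relation.Binary.Permutation.Propositional using (_↭_; ↭-refl; ↭-sym; ↭-trans; ↭-swap; ↭⇒↭ₛ)
open import Data.List.Relation.Binary.Permutation.Propositional.Properties using (shift; ∈-resp-↭; ↭-length; drop-∷)
import Data.List.Relation.Binary.Permutation.Setoid.Properties as ↭ₛ
open import Data.List.Relation.Unary.All as All using (All; []; _∷_)
import Data.List.Relation.Unary.All.Properties as All
open import Data.List.Relation.Unary.Any using (here; there; any?)
open import Data.List.Relation.Unary.AllPairs using (_∷_)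
open import Data.List.Relation.Unary.Unique.Propositional using (Unique)
import Data.List.Relation.Unary.Unique.Propositional.Properties as Unique
open import Data.Nat
  using (ℕ; zero; suc; _≟_; _<?_; _≤?_; _+_; _*_; _∸_; _⊔_; _≤_; _<_; _≥_; _/_; z≤n; s≤s; _≤′_; ≤′-refl; ≤′-step;
         NonZero; ≢-nonZero; >-nonZero⁻¹)
open import Data.Nat.Properties
open import Data.Nat.DivMod using (m*n/n≡m; /-monoˡ-≤; m/n*n≤m; m/n≤m)
open import Data.Nat.Tactic.RingSolver using (solve-∀)
open import Data.Product using (∃; _×_; _,_; proj₁; proj₂)
open import Data.Integer using (_⊖_; ∣_∣)
open import Data.Sum using (_⊎_; inj₁; inj₂)
open import Data.Sum.Properties using (inj₁-injective; inj₂-injective)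
open import Relation.Binary.PropositionalEquality
  using (_≡_; _≢_; refl; sym; trans; cong; cong₂; subst; subst₂; ≢-sym; setoid; module ≡-Reasoning)
open import Relation.Binary.PropositionalEquality.Algebra using (isMagma)
open import Relation.Nullary using (¬_; yes; no)

module _ {A : Set} where

  ∈⇒↭∷ : ∀ {x : A} {xs} → x ∈ xs → ∃ λ ys → xs ↭ x ∷ ys
  ∈⇒↭∷ x∈xs with ys , zs , refl ← ∈-∃++ x∈xs = ys ++ zs , shift _ ys zs

  foldr-↭ : ∀ {_∙_ : Op₂ A} {ε} {xs ys} → IsCommutativeMonoid _≡_ _∙_ ε →
            xs ↭ ys → foldr _∙_ ε xs ≡ foldr _∙_ ε ys
  foldr-↭ cm xs↭ys = ↭ₛ.foldr-commMonoid (setoid A) cm (↭⇒↭ₛ xs↭ys)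

  ∈⇒length≢0 : ∀ {x : A} {xs} → x ∈ xs → length xs ≢ 0
  ∈⇒length≢0 (here _)  ()
  ∈⇒length≢0 (there _) ()

  length≢0⇒∈ : ∀ {xs : List A} → length xs ≢ 0 → ∃ (_∈ xs)
  length≢0⇒∈ {[]}    0≢0 = ⊥-elim (0≢0 refl)
  length≢0⇒∈ {x ∷ _} _   = x , here refl

  ∈-replicate⁻ : ∀ {x e : A} {k} → x ∈ replicate k e → x ≡ e
  ∈-replicate⁻ {e = e} {k} = All.lookup (All.replicate⁺ {P = _≡ e} k refl)

  ∈-∷-replicate⁻ : ∀ {x y e : A} {k} → x ∈ y ∷ replicate k e → x ≢ e → x ≡ y
  ∈-∷-replicate⁻ (here x≡y)  _   = x≡y
  ∈-∷-replicate⁻ (there x∈) x≢e = ⊥-elim (x≢e (∈-replicate⁻ x∈))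

  ↭-pair-padding : ∀ {e x y x′ y′ : A} {k k′} → x ≢ e → y ≢ e →
                   x ∷ y ∷ replicate k e ↭ x′ ∷ y′ ∷ replicate k′ e →
                   (x ≡ x′ × y ≡ y′) ⊎ (x ≡ y′ × y ≡ x′)
  ↭-pair-padding x≢e y≢e σ with ∈-resp-↭ σ (here refl)
  ... | here refl         = inj₁ (refl , ∈-∷-replicate⁻ (∈-resp-↭ (drop-∷ σ) (here refl)) y≢e)
  ... | there (here refl) = inj₂ (refl , ∈-∷-replicate⁻ (∈-resp-↭ (drop-∷ (↭-trans σ (↭-swap _ _ ↭-refl))) (here refl)) y≢e)
  ... | there (there x∈)  = ⊥-elim (x≢e (∈-replicate⁻ x∈))

module _ {A B : Set} where

  infixr 5 _⊎ᴸ_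
  _⊎ᴸ_ : List A → List B → List (A ⊎ B)
  xs ⊎ᴸ ys = map inj₁ xs ++ map inj₂ ys

  length-⊎ᴸ : ∀ xs ys → length (xs ⊎ᴸ ys) ≡ length xs + length ys
  length-⊎ᴸ xs ys = trans (length-++ (map inj₁ xs)) (cong₂ _+_ (length-map inj₁ xs) (length-map inj₂ ys))

  ⊎ᴸ⁺-unique : ∀ {xs ys} → Unique xs → Unique ys → Unique (xs ⊎ᴸ ys)
  ⊎ᴸ⁺-unique !xs !ys = Unique.++⁺ (Unique.map⁺ inj₁-injective !xs) (Unique.map⁺ inj₂-injective !ys) disjoint
    where
    disjoint : ∀ {v} → ¬ (v ∈ map inj₁ _ × v ∈ map inj₂ _)
    disjoint (p , q) with _ , _ , refl ← ∈-map⁻ inj₁ p with _ , _ , () ← ∈-map⁻ inj₂ q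

  All-⊎ᴸ⁺ : ∀ {P : A ⊎ B → Set} {xs ys} → (∀ {x} → x ∈ xs → P (inj₁ x)) → (∀ {y} → y ∈ ys → P (inj₂ y)) →
            All P (xs ⊎ᴸ ys)
  All-⊎ᴸ⁺ P₁ P₂ = All.++⁺ (All.map⁺ (All.tabulate P₁)) (All.map⁺ (All.tabulate P₂))

  ∈-⊎ᴸ⁺ˡ : ∀ {x xs} ys → x ∈ xs → inj₁ x ∈ xs ⊎ᴸ ys
  ∈-⊎ᴸ⁺ˡ ys x∈xs = ∈-++⁺ˡ (∈-map⁺ inj₁ x∈xs)

  ∈-⊎ᴸ⁺ʳ : ∀ {y} xs {ys} → y ∈ ys → inj₂ y ∈ xs ⊎ᴸ ys
  ∈-⊎ᴸ⁺ʳ xs y∈ys = ∈-++⁺ʳ (map inj₁ xs) (∈-map⁺ inj₂ y∈ys)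

  length-cartesianProduct : ∀ (xs : List A) (ys : List B) → length (cartesianProduct xs ys) ≡ length xs * length ys
  length-cartesianProduct []       ys = refl
  length-cartesianProduct (x ∷ xs) ys = trans (length-++ (map (x ,_) ys))
    (cong₂ _+_ (length-map (x ,_) ys) (length-cartesianProduct xs ys))

module InjectiveRelation {X Y : Set} (R : X → Y → Set) (injective : ∀ {x x′ y} → R x y → R x′ y → x ≡ x′) where

  Covered : List Y → X → Set
  Covered ys x = ∃ λ y → y ∈ ys × R x y

  length-≤ : ∀ {xs ys} → Unique xs → All (Covered ys) xs → length xs ≤ length ys
  length-≤ {[]}          _              _                         = z≤n
  length-≤ {x ∷ xs} {ys} (x∉xs ∷ !xs) ((y , y∈ys , xRy) ∷ cover) with ys′ , ys↭ ← ∈⇒↭∷ y∈ys =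
    subst (suc (length xs) ≤_) (sym (↭-length ys↭)) (s≤s (length-≤ !xs (All.zipWith shrink (x∉xs , cover))))
    where
    shrink : ∀ {x′} → x ≢ x′ × Covered ys x′ → Covered ys′ x′
    shrink (x≢x′ , y′ , y′∈ys , x′Ry′) with ∈-resp-↭ ys↭ y′∈ys
    ... | here refl     = ⊥-elim (x≢x′ (injective xRy x′Ry′))
    ... | there y′∈ys′ = y′ , y′∈ys′ , x′Ry′

m*n≤o⇒m≤o/n : ∀ m n o .{{_ : NonZero n}} → m * n ≤ o → m ≤ o / n
m*n≤o⇒m≤o/n m n o m*n≤o = subst (_≤ o / n) (m*n/n≡m m n) (/-monoˡ-≤ n m*n≤o)

m*n≡o⇒n≡o/m : ∀ m n o .{{_ : NonZero m}} → m * n ≡ o → n ≡ o / m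
m*n≡o⇒n≡o/m m n o m*n≡o = trans (sym (m*n/n≡m n m)) (cong (_/ m) (trans (*-comm n m) m*n≡o))

m+n≤m*n/q+q : ∀ q m n .{{_ : NonZero q}} → q ≤ m → q ≤ n → m + n ≤ m * n / q + q
m+n≤m*n/q+q q m n q≤m q≤n with a , refl ← m≤n⇒∃[o]m+o≡n q≤m | b , refl ← m≤n⇒∃[o]m+o≡n q≤n = begin
  q + a + (q + b)            ≡⟨ shuffle q a b ⟨
  q + a + b + q              ≤⟨ +-monoˡ-≤ q (m*n≤o⇒m≤o/n (q + a + b) q _ [q+a+b]*q≤m*n) ⟩
  (q + a) * (q + b) / q + q  ∎
  where
  open ≤-Reasoning
  expand : ∀ q a b → (q + a) * (q + b) ≡ (q + a + b) * q + a * b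
  expand = solve-∀
  [q+a+b]*q≤m*n : (q + a + b) * q ≤ (q + a) * (q + b)
  [q+a+b]*q≤m*n = ≤-trans (m≤m+n _ (a * b)) (≤-reflexive (sym (expand q a b)))
  shuffle : ∀ q a b → q + a + b + q ≡ q + a + (q + b)
  shuffle = solve-∀

n/p≤p*n/[1+p] : ∀ p n .{{_ : NonZero p}} → 2 ≤ p → n / p ≤ p * n / suc p
n/p≤p*n/[1+p] p n 2≤p = m*n≤o⇒m≤o/n (n / p) (suc p) (p * n) (begin
  n / p * suc p   ≤⟨ *-monoʳ-≤ (n / p) (m<m*n p p 2≤p) ⟩
  n / p * (p * p) ≡⟨ *-assoc (n / p) p p ⟨
  n / p * p * p   ≤⟨ *-monoˡ-≤ p (m/n*n≤m n p) ⟩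
  n * p           ≡⟨ *-comm n p ⟩
  p * n           ∎)
  where open ≤-Reasoning

m+n≤o+q⇒m≤o+[q∸n] : ∀ m n o q → m + n ≤ o + q → m ≤ o + (q ∸ n)
m+n≤o+q⇒m≤o+[q∸n] m n o q le = +-cancelʳ-≤ n m (o + (q ∸ n)) (begin
  m + n               ≤⟨ le ⟩
  o + q               ≤⟨ +-monoʳ-≤ o (m≤n+m∸n q n) ⟩
  o + (n + (q ∸ n))   ≡⟨ cong (o +_) (+-comm n (q ∸ n)) ⟩
  o + ((q ∸ n) + n)   ≡⟨ +-assoc o (q ∸ n) n ⟨
  o + (q ∸ n) + n     ∎)
  where open ≤-Reasoning

m*n≤[1+m]*o⇒m*[n∸o]≤o : ∀ m n o → m * n ≤ suc m * o → m * (n ∸ o) ≤ o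
m*n≤[1+m]*o⇒m*[n∸o]≤o m n o le = begin
  m * (n ∸ o)         ≡⟨ *-distribˡ-∸ m n o ⟩
  m * n ∸ m * o       ≤⟨ ∸-monoˡ-≤ (m * o) le ⟩
  o + m * o ∸ m * o   ≡⟨ m+n∸n≡m o (m * o) ⟩
  o                   ∎
  where open ≤-Reasoning

-- Integer +_ is opened only locally: in scope, it makes ℕ sections such as (n +_) ambiguous.
module _ where
  open import Data.Integer using (+_; -_; _-_) renaming (_+_ to _+ℤ_)
  import Data.Integer.Properties as ℤ

  [m-n]-o≡m⊖[n+o] : ∀ m n o → (+ m - + n) - + o ≡ m ⊖ (n + o)
  [m-n]-o≡m⊖[n+o] m n o = begin
    (+ m - + n) - + o          ≡⟨ ℤ.+-assoc (+ m) (- + n) (- + o) ⟩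
    + m +ℤ (- + n +ℤ - + o)    ≡⟨ cong (+ m +ℤ_) (ℤ.neg-distrib-+ (+ n) (+ o)) ⟨
    + m - (+ n +ℤ + o)         ≡⟨ cong (λ i → + m - i) (ℤ.pos-+ n o) ⟨
    + m - + (n + o)            ≡⟨ ℤ.m-n≡m⊖n m (n + o) ⟩
    m ⊖ (n + o)                ∎
    where open ≡-Reasoning

  ∣m⊖n∣≤u⊔v : ∀ {m n u v} → m ≤ n + u → n ≤ m + v → ∣ m ⊖ n ∣ ≤ u ⊔ v
  ∣m⊖n∣≤u⊔v {m} {n} {u} {v} m≤n+u n≤m+v with n ≤? m
  ... | yes n≤m rewrite ℤ.⊖-≥ n≤m  = ≤-trans (m≤n+o⇒m∸n≤o m n m≤n+u) (m≤m⊔n u v)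
  ... | no  n≰m rewrite ℤ.∣⊖∣-≰ n≰m = ≤-trans (m≤n+o⇒m∸n≤o n m n≤m+v) (m≤n⊔m u v)

Eventually : (ℕ → Set) → Set
Eventually P = ∃ λ N → ∀ n → n ≥ N → P n

module _ {P Q : ℕ → Set} where

  eventually-map : (∀ {n} → P n → Q n) → Eventually P → Eventually Q
  eventually-map f (N , P≥) = N , λ n n≥N → f (P≥ n n≥N)

  eventually-∧ : Eventually P → Eventually Q → Eventually (λ n → P n × Q n)
  eventually-∧ (M , P≥) (N , Q≥) = M ⊔ N , λ n n≥ → P≥ n (m⊔n≤o⇒m≤o M N n≥) , Q≥ n (m⊔n≤o⇒n≤o M N n≥)

eventually-≥ : ∀ N → Eventually (N ≤_)
eventually-≥ N = N , λ _ n≥N → n≥N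

eventually-upwards : ∀ {P} → Eventually P → Eventually (λ n → ∀ m → n ≤ m → P m)
eventually-upwards (N , P≥) = N , λ n n≥N m n≤m → P≥ m (≤-trans n≥N n≤m)

eventually-/ : ∀ {P} d .{{_ : NonZero d}} → Eventually P → Eventually (λ n → P (n / d))
eventually-/ d (N , P≥) = d * N , λ n n≥dN → P≥ (n / d) (m*n≤o⇒m≤o/n N d n (subst (_≤ n) (*-comm d N) n≥dN))

eventually-nondecreasing : ∀ (f : ℕ → ℕ) → Eventually (λ n → f n ≤ f (suc n)) →
                           Eventually (λ a → ∀ b → a ≤ b → f a ≤ f b)
eventually-nondecreasing f (N , step) = N , λ a N≤a b a≤b → go N≤a (≤⇒≤′ a≤b)
  where
  go : ∀ {a b} → N ≤ a → a ≤′ b → f a ≤ f b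
  go _   ≤′-refl         = ≤-refl
  go N≤a (≤′-step a≤′b) = ≤-trans (go N≤a a≤′b) (step _ (≤-trans N≤a (≤′⇒≤ a≤′b)))

module Semiring (𝕊 : ArithSemiring) where

  open ArithSemiring 𝕊
  open import Algebra.Structures.Biased {A = S} _≡_ using (isCommutativeMonoidˡ)

  ≢e₊⇒∂≢0 : ∀ {A} → A ≢ e₊ → ∂ A ≢ 0
  ≢e₊⇒∂≢0 A≢e₊ ∂A≡0 = A≢e₊ (∂-zero⁻¹ _ ∂A≡0)

  ∂-e□ : ∂ e□ ≡ 1
  ∂-e□ = *-cancelʳ-≡ (∂ e□) 1 (∂ e□) {{≢-nonZero (≢e₊⇒∂≢0 e□-≢e₊)}} (begin
    ∂ e□ * ∂ e□   ≡⟨ ∂-□ e□ e□ ⟨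
    ∂ (e□ □ e□)   ≡⟨ cong ∂ (□-idˡ e□ e□-≢e₊) ⟩
    ∂ e□          ≡⟨ *-identityˡ (∂ e□) ⟨
    1 * ∂ e□      ∎)
    where open ≡-Reasoning

  1<∂⇒≢e□ : ∀ {A} → 1 < ∂ A → A ≢ e□
  1<∂⇒≢e□ 1<∂A refl = <⇒≢ 1<∂A (sym ∂-e□)

  -- The axioms give e□ □ A ≡ A only for A ≢ e₊; for A = e₊ both sides have degree 0.
  □-identityˡ : ∀ A → e□ □ A ≡ A
  □-identityˡ A with ∂ A ≟ 0
  ... | no  ∂A≢0 = □-idˡ A (λ A≡e₊ → ∂A≢0 (trans (cong ∂ A≡e₊) ∂-zero))
  ... | yes ∂A≡0 = trans (∂-zero⁻¹ _ ∂[e□□A]≡0) (sym (∂-zero⁻¹ A ∂A≡0))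
    where
    ∂[e□□A]≡0 : ∂ (e□ □ A) ≡ 0
    ∂[e□□A]≡0 = trans (∂-□ e□ A) (trans (cong (∂ e□ *_) ∂A≡0) (*-zeroʳ (∂ e□)))

  ⊕-isCommutativeMonoid : IsCommutativeMonoid _≡_ _⊕_ e₊
  ⊕-isCommutativeMonoid = isCommutativeMonoidˡ record
    { isSemigroup = record { isMagma = isMagma _⊕_ ; assoc = ⊕-assoc }
    ; identityˡ   = ⊕-idˡ
    ; comm        = ⊕-comm
    }

  □-isCommutativeMonoid : IsCommutativeMonoid _≡_ _□_ e□
  □-isCommutativeMonoid = isCommutativeMonoidˡ record
    { isSemigroup = record { isMagma = isMagma _□_ ; assoc = □-assoc }
    ; identityˡ   = □-identityˡ
    ; comm        = □-comm
    }

  sumL-↭ : ∀ {xs ys} → xs ↭ ys → sumL xs ≡ sumL ys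
  sumL-↭ = foldr-↭ ⊕-isCommutativeMonoid

  prodL-↭ : ∀ {xs ys} → xs ↭ ys → prodL xs ≡ prodL ys
  prodL-↭ = foldr-↭ □-isCommutativeMonoid

  sumL-[_] : ∀ A → sumL [ A ] ≡ A
  sumL-[ A ] = IsCommutativeMonoid.identityʳ ⊕-isCommutativeMonoid A

  prodL-[_] : ∀ A → prodL [ A ] ≡ A
  prodL-[ A ] = IsCommutativeMonoid.identityʳ □-isCommutativeMonoid A

  ∂-factors : ∀ {A P B} → A ≡ P □ B → ∂ P * ∂ B ≡ ∂ A
  ∂-factors {P = P} {B} A≡P□B = trans (sym (∂-□ P B)) (cong ∂ (sym A≡P□B))

  ∂≤∂-□ : ∀ A {B} → B ≢ e₊ → ∂ A ≤ ∂ (A □ B)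
  ∂≤∂-□ A {B} B≢e₊ = subst (∂ A ≤_) (sym (∂-□ A B)) (m≤m*n (∂ A) (∂ B) {{≢-nonZero (≢e₊⇒∂≢0 B≢e₊)}})

  addPrimes⁺ : ∀ {A n} → IsAddPrime A → ∂ A ≡ n → A ∈ addPrimes n
  addPrimes⁺ aA refl = aA

  addPrimes⁻ : ∀ {A n} → A ∈ addPrimes n → IsAddPrime A
  addPrimes⁻ {A} {n} A∈ = subst (λ k → A ∈ addPrimes k) (sym (addPrimes-sound n A A∈)) A∈

  mulPrimes⁺ : ∀ {A n} → IsMulPrime A → ∂ A ≡ n → A ∈ mulPrimes n
  mulPrimes⁺ mA refl = mA

  mulPrimes⁻ : ∀ {A n} → A ∈ mulPrimes n → IsMulPrime A
  mulPrimes⁻ {A} {n} A∈ = subst (λ k → A ∈ mulPrimes k) (sym (mulPrimes-sound n A A∈)) A∈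

  level⁺ : ∀ {A n} → ∂ A ≡ n → A ∈ level n
  level⁺ {A} refl = level-comp A

  AddFactorisation : S → List S → Set
  AddFactorisation A xs = (∀ x → x ∈ xs → IsAddPrime x) × sumL xs ≡ A

  MulFactorisation : S → List S → Set
  MulFactorisation A xs = (∀ x → x ∈ xs → IsMulPrime x) × prodL xs ≡ A

  addFactorisation-unique : ∀ {A xs ys} → AddFactorisation A xs → AddFactorisation A ys → xs ↭ ys
  addFactorisation-unique (pxs , Σxs≡A) (pys , Σys≡A) = add-unique _ _ pxs pys (trans Σxs≡A (sym Σys≡A))

  mulFactorisation-unique : ∀ {A xs ys} → MulFactorisation A xs → MulFactorisation A ys → xs ↭ ys
  mulFactorisation-unique (pxs , Πxs≡A) (pys , Πys≡A) = mul-unique _ _ pxs pys (trans Πxs≡A (sym Πys≡A))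

  addPrime-factorisation-length : ∀ {A xs} → IsAddPrime A → AddFactorisation A xs → length xs ≡ 1
  addPrime-factorisation-length {A} aA fA =
    ↭-length (addFactorisation-unique {ys = [ A ]} fA ((λ { _ (here refl) → aA }) , sumL-[ A ]))

  mulPrime-factorisation-length : ∀ {A xs} → IsMulPrime A → MulFactorisation A xs → length xs ≡ 1
  mulPrime-factorisation-length {A} mA fA =
    ↭-length (mulFactorisation-unique {ys = [ A ]} fA ((λ { _ (here refl) → mA }) , prodL-[ A ]))

  prodL-addPrime : ∀ {xs} → (∀ x → x ∈ xs → IsMulPrime x) → IsAddPrime (prodL xs)
  prodL-addPrime {[]}     _      = e□-addPrime
  prodL-addPrime {x ∷ xs} primes = addPrime-□ x (prodL xs) (mulPrime-addPrime x (primes x (here refl)))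
                                     (prodL-addPrime (λ y y∈xs → primes y (there y∈xs)))

  ∷-mulFactorisation : ∀ {P B xs} → IsMulPrime P → MulFactorisation B xs → MulFactorisation (P □ B) (P ∷ xs)
  ∷-mulFactorisation mP (primes , Πxs≡B) = (λ { _ (here refl) → mP ; x (there x∈xs) → primes x x∈xs }) , cong (_ □_) Πxs≡B

  ⊕e□-addFactorisation : ∀ {A xs} → AddFactorisation A xs → AddFactorisation (A ⊕ e□) (e□ ∷ xs)
  ⊕e□-addFactorisation (primes , Σxs≡A) =
    (λ { _ (here refl) → e□-addPrime ; x (there x∈xs) → primes x x∈xs }) , trans (cong (e□ ⊕_) Σxs≡A) (⊕-comm e□ _)

  mulPrime≢□ : ∀ {Q P B xs} → IsMulPrime Q → IsMulPrime P → B ≢ e□ → MulFactorisation B xs → Q ≢ P □ B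
  mulPrime≢□ {xs = []}    _  _  B≢e□ (_ , e□≡B) _   = B≢e□ (sym e□≡B)
  mulPrime≢□ {xs = _ ∷ _} mQ mP _    fB         Q≡P□B
    with () ← mulPrime-factorisation-length mQ (subst (λ A → MulFactorisation A _) (sym Q≡P□B) (∷-mulFactorisation mP fB))

  ⊕e□-injective : ∀ {A B} → A ⊕ e□ ≡ B ⊕ e□ → A ≡ B
  ⊕e□-injective {A} {B} A⊕e□≡B⊕e□ with xs , fA ← add-exists A | ys , fB ← add-exists B = begin
    A        ≡⟨ proj₂ fA ⟨
    sumL xs  ≡⟨ sumL-↭ (drop-∷ (addFactorisation-unique (⊕e□-addFactorisation fA) fB′)) ⟩
    sumL ys  ≡⟨ proj₂ fB ⟩
    B        ∎
    where
    open ≡-Reasoning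
    fB′ : AddFactorisation (A ⊕ e□) (e□ ∷ ys)
    fB′ = subst (λ C → AddFactorisation C (e□ ∷ ys)) (sym A⊕e□≡B⊕e□) (⊕e□-addFactorisation fB)

  ⊕e□-not-addPrime : ∀ {A} → A ≢ e₊ → ¬ IsAddPrime (A ⊕ e□)
  ⊕e□-not-addPrime {A} A≢e₊ aA⊕e□ with add-exists A
  ... | []    , _ , e₊≡A = A≢e₊ (sym e₊≡A)
  ... | _ ∷ _ , fA with () ← addPrime-factorisation-length aA⊕e□ (⊕e□-addFactorisation fA)

  S⁺≤Sc : ∀ n → S⁺ n ≤ Sc n
  S⁺≤Sc n = InjectiveRelation.length-≤ _≡_ (λ A≡B A′≡B → trans A≡B (sym A′≡B)) (addPrimes-unique n)
    (All.tabulate λ {A} A∈ → A , level⁺ (addPrimes-sound n A A∈) , refl)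

  -- Degree n + 1 contains the shifts C ⊕ e□ of degree n, none of which is an additive prime.
  Sc-growth : ∀ {n} → n ≢ 0 → Sc n + S⁺ (suc n) ≤ Sc (suc n)
  Sc-growth {n} n≢0 = subst (_≤ Sc (suc n)) (length-⊎ᴸ (level n) (addPrimes (suc n)))
    (length-≤ (⊎ᴸ⁺-unique (level-unique n) (addPrimes-unique (suc n))) (All-⊎ᴸ⁺ coverShifted coverPrime))
    where
    _↦_ : S ⊎ S → S → Set
    inj₁ C ↦ D = C ≢ e₊ × D ≡ C ⊕ e□
    inj₂ A ↦ D = IsAddPrime A × D ≡ A

    shifted≢prime : ∀ {C A} → C ≢ e₊ → IsAddPrime A → A ≢ C ⊕ e□
    shifted≢prime C≢e₊ aA A≡C⊕e□ = ⊕e□-not-addPrime C≢e₊ (subst IsAddPrime A≡C⊕e□ aA)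

    ↦-injective : ∀ {x x′ D} → x ↦ D → x′ ↦ D → x ≡ x′
    ↦-injective {inj₁ _} {inj₁ _} (_ , D≡) (_ , D≡′)      = cong inj₁ (⊕e□-injective (trans (sym D≡) D≡′))
    ↦-injective {inj₁ _} {inj₂ _} (C≢e₊ , D≡) (aA , D≡′) = ⊥-elim (shifted≢prime C≢e₊ aA (trans (sym D≡′) D≡))
    ↦-injective {inj₂ _} {inj₁ _} (aA , D≡) (C≢e₊ , D≡′) = ⊥-elim (shifted≢prime C≢e₊ aA (trans (sym D≡) D≡′))
    ↦-injective {inj₂ _} {inj₂ _} (_ , D≡) (_ , D≡′)      = cong inj₂ (trans (sym D≡) D≡′)

    open InjectiveRelation _↦_ ↦-injective

    coverShifted : ∀ {C} → C ∈ level n → Covered (level (suc n)) (inj₁ C)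
    coverShifted {C} C∈ = C ⊕ e□ , level⁺ ∂[C⊕e□]≡1+n , C≢e₊ , refl
      where
      ∂C≡n : ∂ C ≡ n
      ∂C≡n = level-sound n C C∈
      ∂[C⊕e□]≡1+n : ∂ (C ⊕ e□) ≡ suc n
      ∂[C⊕e□]≡1+n = trans (∂-⊕ C e□) (trans (cong₂ _+_ ∂C≡n ∂-e□) (+-comm n 1))
      C≢e₊ : C ≢ e₊
      C≢e₊ C≡e₊ = n≢0 (trans (sym ∂C≡n) (trans (cong ∂ C≡e₊) ∂-zero))

    coverPrime : ∀ {A} → A ∈ addPrimes (suc n) → Covered (level (suc n)) (inj₂ A)
    coverPrime {A} A∈ = A , level⁺ (addPrimes-sound _ A A∈) , addPrimes⁻ A∈ , refl

  G₁⁺⇒Sc≤ : AxiomG₁⁺ → ∀ k → Eventually (λ n → k * Sc n ≤ suc k * S⁺ n)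
  G₁⁺⇒Sc≤ G₁⁺ k = eventually-map
    (λ {n} bound → +-cancelˡ-≤ (Sc n) _ _ (subst (Sc n + k * Sc n ≤_) (+-comm _ (Sc n)) bound)) (G₁⁺ k)

  G₁⁺⇒Sc∸S⁺≤ : AxiomG₁⁺ → ∀ k → Eventually (λ n → k * (Sc n ∸ S⁺ n) ≤ S⁺ n)
  G₁⁺⇒Sc∸S⁺≤ G₁⁺ k = eventually-map (m*n≤[1+m]*o⇒m*[n∸o]≤o k _ _) (G₁⁺⇒Sc≤ G₁⁺ k)

  G₁⁺⇒Sc≤S⁺-suc : AxiomG₁⁺ → ∀ k → Eventually (λ n → k * Sc n ≤ S⁺ (suc n))
  G₁⁺⇒Sc≤S⁺-suc G₁⁺ k with N , bound ← G₁⁺⇒Sc≤ G₁⁺ k = suc N , λ n n>N → +-cancelʳ-≤ (k * S⁺ (suc n)) _ _ (begin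
    k * Sc n + k * S⁺ (suc n)    ≡⟨ *-distribˡ-+ k (Sc n) (S⁺ (suc n)) ⟨
    k * (Sc n + S⁺ (suc n))      ≤⟨ *-monoʳ-≤ k (Sc-growth (m<n⇒n≢0 n>N)) ⟩
    k * Sc (suc n)               ≤⟨ bound (suc n) (m≤n⇒m≤1+n (<⇒≤ n>N)) ⟩
    S⁺ (suc n) + k * S⁺ (suc n)  ∎)
    where open ≤-Reasoning

  FreeOfDegree : ℕ → S → Set
  FreeOfDegree d A = ∃ λ xs → MulFactorisation A xs × All (λ x → ∂ x ≢ d) xs

  data FactorOfDegree (d : ℕ) (A : S) : Set where
    found : ∀ P B → IsMulPrime P → ∂ P ≡ d → IsAddPrime B → A ≡ P □ B → FactorOfDegree d A
    none  : FreeOfDegree d A → FactorOfDegree d A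

  factorOfDegree? : ∀ d {A} → IsAddPrime A → FactorOfDegree d A
  factorOfDegree? d {A} aA with xs , primes , Πxs≡A ← mul-exists A aA with any? (λ x → ∂ x ≟ d) xs
  ... | no  ¬has = none (xs , (primes , Πxs≡A) , All.¬Any⇒All¬ xs ¬has)
  ... | yes has with P , P∈xs , ∂P≡d ← find has with ys , xs↭P∷ys ← ∈⇒↭∷ P∈xs =
    found P (prodL ys) (primes P P∈xs) ∂P≡d (prodL-addPrime primes-ys) (trans (sym Πxs≡A) (prodL-↭ xs↭P∷ys))
    where
    primes-ys : ∀ y → y ∈ ys → IsMulPrime y
    primes-ys y y∈ys = primes y (∈-resp-↭ (↭-sym xs↭P∷ys) (there y∈ys))

  □-cancel-factorOfDegree : ∀ {d P P′ B B′ xs} → IsMulPrime P → ∂ P ≡ d → IsMulPrime P′ →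
                            MulFactorisation B xs → FreeOfDegree d B′ → P □ B ≡ P′ □ B′ → P ≡ P′ × B ≡ B′
  □-cancel-factorOfDegree mP ∂P≡d mP′ fB (ys , fB′ , ∂ys≢d) P□B≡P′□B′
    with σ ← mulFactorisation-unique (∷-mulFactorisation mP fB)
               (subst (λ A → MulFactorisation A _) (sym P□B≡P′□B′) (∷-mulFactorisation mP′ fB′))
    with ∈-resp-↭ σ (here refl)
  ... | here refl  = refl , trans (sym (proj₂ fB)) (trans (prodL-↭ (drop-∷ σ)) (proj₂ fB′))
  ... | there P∈ys = ⊥-elim (All.lookup ∂ys≢d P∈ys ∂P≡d)

  padded : S → S → ℕ → List S
  padded P B k = P ∷ B ∷ replicate k e□

  ∂-padded : ∀ P B k → ∂ (sumL (padded P B k)) ≡ ∂ P + ∂ B + k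
  ∂-padded P B k = begin
    ∂ (P ⊕ (B ⊕ sumL (replicate k e□)))    ≡⟨ ∂-⊕ P _ ⟩
    ∂ P + ∂ (B ⊕ sumL (replicate k e□))    ≡⟨ cong (∂ P +_) (∂-⊕ B _) ⟩
    ∂ P + (∂ B + ∂ (sumL (replicate k e□))) ≡⟨ cong (λ m → ∂ P + (∂ B + m)) (∂-sumL-replicate k) ⟩
    ∂ P + (∂ B + k)                        ≡⟨ +-assoc (∂ P) (∂ B) k ⟨
    ∂ P + ∂ B + k                          ∎
    where
    open ≡-Reasoning
    ∂-sumL-replicate : ∀ k → ∂ (sumL (replicate k e□)) ≡ k
    ∂-sumL-replicate zero    = ∂-zero
    ∂-sumL-replicate (suc k) = trans (∂-⊕ e□ _) (cong₂ _+_ ∂-e□ (∂-sumL-replicate k))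

  record Encodes (C A : S) : Set where
    constructor encoding
    field
      P B        : S
      padding    : ℕ
      P-addPrime : IsAddPrime P
      B-addPrime : IsAddPrime B
      P≢e□       : P ≢ e□
      B≢e□       : B ≢ e□
      C≡sum      : C ≡ sumL (padded P B padding)
      A≡P□B      : A ≡ P □ B

    addFactorisation : AddFactorisation C (padded P B padding)
    addFactorisation = primes , sym C≡sum
      where
      primes : ∀ x → x ∈ padded P B padding → IsAddPrime x
      primes _ (here refl)         = P-addPrime
      primes _ (there (here refl)) = B-addPrime
      primes _ (there (there x∈))  = subst IsAddPrime (sym (∈-replicate⁻ x∈)) e□-addPrime

  encodes-injective : ∀ {C A A′} → Encodes C A → Encodes C A′ → A ≡ A′
  encodes-injective e@(encoding P B _ _ _ P≢e□ B≢e□ _ A≡P□B) e′@(encoding P′ B′ _ _ _ _ _ _ A′≡P′□B′)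
    with ↭-pair-padding P≢e□ B≢e□ (addFactorisation-unique (Encodes.addFactorisation e) (Encodes.addFactorisation e′))
  ... | inj₁ (refl , refl) = trans A≡P□B (sym A′≡P′□B′)
  ... | inj₂ (refl , refl) = trans A≡P□B (trans (□-comm P B) (sym A′≡P′□B′))

  encoding-not-addPrime : ∀ {C A} → Encodes C A → ¬ IsAddPrime C
  encoding-not-addPrime e aC with () ← addPrime-factorisation-length aC (Encodes.addFactorisation e)

  module LeastMulDegree (p : ℕ) .{{_ : NonZero p}} (least : IsLeastMulDegree p) where

    p≤∂-mulPrime : ∀ {Q} → IsMulPrime Q → p ≤ ∂ Q
    p≤∂-mulPrime {Q} mQ with ∂ Q <? p
    ... | yes ∂Q<p = ⊥-elim (∈⇒length≢0 mQ (proj₂ least (∂ Q) ∂Q<p))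
    ... | no  ∂Q≮p = ≮⇒≥ ∂Q≮p

    p<∂-mulPrime : ∀ {Q} → IsMulPrime Q → ∂ Q ≢ p → p < ∂ Q
    p<∂-mulPrime mQ ∂Q≢p = ≤∧≢⇒< (p≤∂-mulPrime mQ) (≢-sym ∂Q≢p)

    -- The only additive prime of degree 1 is e□, which is not a multiplicative prime.
    2≤p : 2 ≤ p
    2≤p with Q , Q∈ ← length≢0⇒∈ (proj₁ least) = ≤∧≢⇒< (>-nonZero⁻¹ p) 1≢p
      where
      mQ = mulPrimes⁻ Q∈
      1≢p : 1 ≢ p
      1≢p 1≡p = mulPrime-≢e□ Q mQ (deg1-addPrime Q (mulPrime-addPrime Q mQ) (trans (mulPrimes-sound p Q Q∈) (sym 1≡p)))

    p<∂⇒≢e□ : ∀ {A} → p < ∂ A → A ≢ e□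
    p<∂⇒≢e□ p<∂A = 1<∂⇒≢e□ (≤-<-trans (>-nonZero⁻¹ p) p<∂A)

    data Shape (A : S) : Set where
      mulPrime     : IsMulPrime A → Shape A
      leastFactor  : ∀ P B → IsMulPrime P → ∂ P ≡ p → IsAddPrime B → A ≡ P □ B → Shape A
      largeFactors : ∀ P B → IsAddPrime P → IsAddPrime B → p < ∂ P → p < ∂ B → A ≡ P □ B → Shape A

    shape : ∀ {A} → IsAddPrime A → A ≢ e□ → Shape A
    shape aA A≢e□ with factorOfDegree? p aA
    ... | found P B mP ∂P≡p aB A≡P□B = leastFactor P B mP ∂P≡p aB A≡P□B
    ... | none ([]     , (_ , e□≡A) , _) = ⊥-elim (A≢e□ (sym e□≡A))
    ... | none (Q ∷ [] , (primes , Q□e□≡A) , _) =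
      mulPrime (subst IsMulPrime (trans (sym prodL-[ Q ]) Q□e□≡A) (primes Q (here refl)))
    ... | none (x ∷ y ∷ zs , (primes , Π≡A) , ∂x≢p ∷ ∂y≢p ∷ _) =
      largeFactors x (prodL (y ∷ zs)) (mulPrime-addPrime x mx) (prodL-addPrime primes-y∷zs)
        (p<∂-mulPrime mx ∂x≢p) (<-≤-trans (p<∂-mulPrime my ∂y≢p) (∂≤∂-□ y (addPrime-≢e₊ _ (prodL-addPrime primes-zs))))
        (sym Π≡A)
      where
      mx = primes x (here refl)
      my = primes y (there (here refl))
      primes-y∷zs : ∀ z → z ∈ y ∷ zs → IsMulPrime z
      primes-y∷zs z z∈ = primes z (there z∈)
      primes-zs : ∀ z → z ∈ zs → IsMulPrime z
      primes-zs z z∈ = primes z (there (there z∈))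

    encodingDegree : ℕ → ℕ
    encodingDegree n = n / suc p + p + 1

    encode : ∀ {n P B} → IsAddPrime P → IsAddPrime B → p < ∂ P → p < ∂ B → ∂ P * ∂ B ≡ n →
             ∃ λ C → C ∈ level (encodingDegree n) × Encodes C (P □ B)
    encode {n} {P} {B} aP aB p<∂P p<∂B ∂P*∂B≡n =
      sumL (padded P B k) , level⁺ ∂C≡ , encoding P B k aP aB (p<∂⇒≢e□ p<∂P) (p<∂⇒≢e□ p<∂B) refl refl
      where
      ∂P+∂B≤ : ∂ P + ∂ B ≤ encodingDegree n
      ∂P+∂B≤ = subst (∂ P + ∂ B ≤_)
        (trans (cong (λ m → m / suc p + suc p) ∂P*∂B≡n) (trans (+-suc (n / suc p) p) (+-comm 1 (n / suc p + p))))
        (m+n≤m*n/q+q (suc p) (∂ P) (∂ B) p<∂P p<∂B)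
      k = encodingDegree n ∸ (∂ P + ∂ B)
      ∂C≡ : ∂ (sumL (padded P B k)) ≡ encodingDegree n
      ∂C≡ = trans (∂-padded P B k) (m+[n∸m]≡n ∂P+∂B≤)

    S⁺-upperBound : ∀ {n} → 1 < n → (Bs : List S) → (∀ {B} → IsAddPrime B → p * ∂ B ≡ n → B ∈ Bs) →
                    S⁺ n + S⁺ (encodingDegree n) ≤ S□ n + (S□ p * length Bs + Sc (encodingDegree n))
    S⁺-upperBound {n} 1<n Bs ∈Bs = subst₂ _≤_ (length-⊎ᴸ (addPrimes n) (addPrimes m)) targets-length
      (length-≤ (⊎ᴸ⁺-unique (addPrimes-unique n) (addPrimes-unique m)) (All-⊎ᴸ⁺ coverDegree-n coverDegree-m))
      where
      m = encodingDegree n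
      targets = mulPrimes n ⊎ᴸ cartesianProduct (mulPrimes p) Bs ⊎ᴸ level m

      targets-length : length targets ≡ S□ n + (S□ p * length Bs + Sc m)
      targets-length = trans (length-⊎ᴸ (mulPrimes n) _) (cong (S□ n +_)
        (trans (length-⊎ᴸ (cartesianProduct (mulPrimes p) Bs) _) (cong (_+ Sc m) (length-cartesianProduct (mulPrimes p) Bs))))

      _↦_ : S ⊎ S → S ⊎ ((S × S) ⊎ S) → Set
      inj₁ A ↦ inj₁ Q                = A ≡ Q
      inj₁ A ↦ inj₂ (inj₁ (P , B))   = A ≡ P □ B
      inj₁ A ↦ inj₂ (inj₂ C)         = Encodes C A
      inj₂ A ↦ inj₂ (inj₂ C)         = IsAddPrime A × A ≡ C
      inj₂ _ ↦ _                     = ⊥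

      ↦-injective : ∀ {x x′ y} → x ↦ y → x′ ↦ y → x ≡ x′
      ↦-injective {inj₁ _} {inj₁ _} {inj₁ _}        A≡ A′≡         = cong inj₁ (trans A≡ (sym A′≡))
      ↦-injective {inj₁ _} {inj₁ _} {inj₂ (inj₁ _)} A≡ A′≡         = cong inj₁ (trans A≡ (sym A′≡))
      ↦-injective {inj₁ _} {inj₁ _} {inj₂ (inj₂ _)} e e′           = cong inj₁ (encodes-injective e e′)
      ↦-injective {inj₁ _} {inj₂ _} {inj₂ (inj₂ _)} e (aA , refl) = ⊥-elim (encoding-not-addPrime e aA)
      ↦-injective {inj₂ _} {inj₁ _} {inj₂ (inj₂ _)} (aA , refl) e = ⊥-elim (encoding-not-addPrime e aA)
      ↦-injective {inj₂ _} {inj₂ _} {inj₂ (inj₂ _)} (_ , A≡) (_ , A′≡) = cong inj₂ (trans A≡ (sym A′≡))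

      open InjectiveRelation _↦_ ↦-injective

      coverShape : ∀ {A} → ∂ A ≡ n → Shape A → Covered targets (inj₁ A)
      coverShape {A} ∂A≡n (mulPrime mA) = inj₁ A , ∈-⊎ᴸ⁺ˡ _ (mulPrimes⁺ mA ∂A≡n) , refl
      coverShape ∂A≡n (leastFactor P B mP ∂P≡p aB A≡P□B) =
        inj₂ (inj₁ (P , B)) ,
        ∈-⊎ᴸ⁺ʳ (mulPrimes n) (∈-⊎ᴸ⁺ˡ (level m) (∈-cartesianProduct⁺ (mulPrimes⁺ mP ∂P≡p) (∈Bs aB p*∂B≡n))) ,
        A≡P□B
        where p*∂B≡n = trans (cong (_* ∂ B) (sym ∂P≡p)) (trans (∂-factors A≡P□B) ∂A≡n)
      coverShape ∂A≡n (largeFactors P B aP aB p<∂P p<∂B A≡P□B)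
        with C , C∈ , enc ← encode aP aB p<∂P p<∂B (trans (∂-factors A≡P□B) ∂A≡n) =
        inj₂ (inj₂ C) , ∈-⊎ᴸ⁺ʳ (mulPrimes n) (∈-⊎ᴸ⁺ʳ _ C∈) , subst (Encodes C) (sym A≡P□B) enc

      coverDegree-n : ∀ {A} → A ∈ addPrimes n → Covered targets (inj₁ A)
      coverDegree-n {A} A∈ = coverShape ∂A≡n (shape (addPrimes⁻ A∈) (1<∂⇒≢e□ (subst (1 <_) (sym ∂A≡n) 1<n)))
        where ∂A≡n = addPrimes-sound n A A∈

      coverDegree-m : ∀ {C} → C ∈ addPrimes m → Covered targets (inj₂ C)
      coverDegree-m {C} C∈ =
        inj₂ (inj₂ C) , ∈-⊎ᴸ⁺ʳ (mulPrimes n) (∈-⊎ᴸ⁺ʳ _ (level⁺ (addPrimes-sound m C C∈))) , addPrimes⁻ C∈ , refl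

    S⁺-bound : ∀ {n} → 1 < n → S⁺ n ≤ S□ n + (S□ p * Sc (n / p) + Sc (encodingDegree n))
    S⁺-bound {n} 1<n = ≤-trans (m≤m+n (S⁺ n) _) (S⁺-upperBound 1<n (level (n / p)) ∈level)
      where
      ∈level : ∀ {B} → IsAddPrime B → p * ∂ B ≡ n → B ∈ level (n / p)
      ∈level {B} _ p*∂B≡n = level⁺ (m*n≡o⇒n≡o/m p (∂ B) n p*∂B≡n)

    S⁺[pn]-lowerBound : ∀ {n} → 1 < n → S□ p * S⁺ n + S□ (p * n) ≤ S⁺ (p * n) + S□ p * (S□ p * S⁺ (n / p))
    S⁺[pn]-lowerBound {n} 1<n = subst₂ _≤_ sources-length targets-length
      (length-≤ (⊎ᴸ⁺-unique (Unique.cartesianProduct⁺ (mulPrimes-unique p) (addPrimes-unique n)) (mulPrimes-unique (p * n)))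
                (All-⊎ᴸ⁺ coverPair coverMulPrime))
      where
      pairs = cartesianProduct (mulPrimes p) (addPrimes n)
      triples = cartesianProduct (mulPrimes p) (cartesianProduct (mulPrimes p) (addPrimes (n / p)))
      targets = addPrimes (p * n) ⊎ᴸ triples

      sources-length : length (pairs ⊎ᴸ mulPrimes (p * n)) ≡ S□ p * S⁺ n + S□ (p * n)
      sources-length = trans (length-⊎ᴸ pairs _) (cong (_+ S□ (p * n)) (length-cartesianProduct (mulPrimes p) (addPrimes n)))

      targets-length : length targets ≡ S⁺ (p * n) + S□ p * (S□ p * S⁺ (n / p))
      targets-length = trans (length-⊎ᴸ (addPrimes (p * n)) triples) (cong (S⁺ (p * n) +_)
        (trans (length-cartesianProduct (mulPrimes p) _) (cong (S□ p *_) (length-cartesianProduct (mulPrimes p) _))))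

      _↦_ : (S × S) ⊎ S → S ⊎ (S × (S × S)) → Set
      inj₁ (P , B) ↦ inj₁ A            = IsMulPrime P × ∂ P ≡ p × B ≢ e□ × FreeOfDegree p B × A ≡ P □ B
      inj₁ (P , B) ↦ inj₂ (P′ , Q , C) = P ≡ P′ × B ≡ Q □ C
      inj₂ Q       ↦ inj₁ A            = IsMulPrime Q × Q ≡ A
      inj₂ _       ↦ inj₂ _            = ⊥

      ↦-injective : ∀ {x x′ y} → x ↦ y → x′ ↦ y → x ≡ x′
      ↦-injective {inj₁ _} {inj₁ _} {inj₁ _} (mP , ∂P≡p , _ , (_ , fB , _) , A≡) (mP′ , _ , _ , freeB′ , A≡′)
        with refl , refl ← □-cancel-factorOfDegree mP ∂P≡p mP′ fB freeB′ (trans (sym A≡) A≡′) = refl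
      ↦-injective {inj₁ _} {inj₁ _} {inj₂ _} (refl , B≡) (refl , B′≡) = cong (λ B → inj₁ (_ , B)) (trans B≡ (sym B′≡))
      ↦-injective {inj₁ _} {inj₂ _} {inj₁ _} (mP , _ , B≢e□ , (_ , fB , _) , A≡) (mQ , Q≡A) =
        ⊥-elim (mulPrime≢□ mQ mP B≢e□ fB (trans Q≡A A≡))
      ↦-injective {inj₂ _} {inj₁ _} {inj₁ _} (mQ , Q≡A) (mP , _ , B≢e□ , (_ , fB , _) , A≡) =
        ⊥-elim (mulPrime≢□ mQ mP B≢e□ fB (trans Q≡A A≡))
      ↦-injective {inj₂ _} {inj₂ _} {inj₁ _} (_ , Q≡A) (_ , Q′≡A) = cong inj₂ (trans Q≡A (sym Q′≡A))

      open InjectiveRelation _↦_ ↦-injective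

      coverPair : ∀ {PB} → PB ∈ pairs → Covered targets (inj₁ PB)
      coverPair {P , B} PB∈ with P∈ , B∈ ← ∈-cartesianProduct⁻ (mulPrimes p) (addPrimes n) PB∈
        with factorOfDegree? p (addPrimes⁻ B∈)
      ... | found P′ C mP′ ∂P′≡p aC B≡P′□C =
        inj₂ (P , P′ , C) ,
        ∈-⊎ᴸ⁺ʳ (addPrimes (p * n)) (∈-cartesianProduct⁺ P∈ (∈-cartesianProduct⁺ (mulPrimes⁺ mP′ ∂P′≡p) C∈)) ,
        refl , B≡P′□C
        where
        p*∂C≡n : p * ∂ C ≡ n
        p*∂C≡n = trans (cong (_* ∂ C) (sym ∂P′≡p)) (trans (∂-factors B≡P′□C) (addPrimes-sound n B B∈))
        C∈ : C ∈ addPrimes (n / p)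
        C∈ = addPrimes⁺ aC (m*n≡o⇒n≡o/m p (∂ C) n p*∂C≡n)
      ... | none freeB =
        inj₁ (P □ B) , ∈-⊎ᴸ⁺ˡ triples (addPrimes⁺ aP□B ∂P□B≡pn) , mP , ∂P≡p , B≢e□ , freeB , refl
        where
        mP : IsMulPrime P
        mP = mulPrimes⁻ P∈
        ∂P≡p : ∂ P ≡ p
        ∂P≡p = mulPrimes-sound p P P∈
        ∂B≡n : ∂ B ≡ n
        ∂B≡n = addPrimes-sound n B B∈
        aP□B : IsAddPrime (P □ B)
        aP□B = addPrime-□ P B (mulPrime-addPrime P mP) (addPrimes⁻ B∈)
        ∂P□B≡pn : ∂ (P □ B) ≡ p * n
        ∂P□B≡pn = trans (∂-□ P B) (cong₂ _*_ ∂P≡p ∂B≡n)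
        B≢e□ : B ≢ e□
        B≢e□ = 1<∂⇒≢e□ (subst (1 <_) (sym ∂B≡n) 1<n)

      coverMulPrime : ∀ {Q} → Q ∈ mulPrimes (p * n) → Covered targets (inj₂ Q)
      coverMulPrime {Q} Q∈ = inj₁ Q , ∈-⊎ᴸ⁺ˡ triples (addPrimes⁺ (mulPrime-addPrime Q mQ) (mulPrimes-sound _ Q Q∈)) , mQ , refl
        where mQ = mulPrimes⁻ Q∈

    S⁺[pn]-estimate-at : ∀ k n → let j = n / p in
      2 ≤ j → suc k * (S□ p * S□ p) * Sc j ≤ S⁺ (suc j) →
      (∀ m → j ≤ m → suc k * (Sc m ∸ S⁺ m) ≤ S⁺ m) → (∀ a → j ≤ a → ∀ b → a ≤ b → S⁺ a ≤ S⁺ b) →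
      suc k * ∣ S⁺ (p * n) ⊖ (S□ (p * n) + S□ p * S⁺ n) ∣ ≤ S⁺ (encodingDegree (p * n))
    S⁺[pn]-estimate-at k n 2≤j negligible excess nondecreasing = begin
      suc k * ∣ a ⊖ (b + c) ∣  ≤⟨ *-monoʳ-≤ (suc k) (∣m⊖n∣≤u⊔v upper lower) ⟩
      suc k * (u ⊔ v)         ≡⟨ *-distribˡ-⊔ (suc k) u v ⟩
      suc k * u ⊔ suc k * v   ≤⟨ ⊔-lub (excess m (≤-trans (n≤1+n j) 1+j≤m)) small ⟩
      S⁺ m                    ∎
      where
      open ≤-Reasoning
      j = n / p
      m = encodingDegree (p * n)
      a = S⁺ (p * n)
      b = S□ (p * n)
      c = S□ p * S⁺ n
      u = Sc m ∸ S⁺ m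
      v = S□ p * (S□ p * S⁺ j)

      1<n : 1 < n
      1<n = ≤-trans 2≤j (m/n≤m n p)

      1+j≤m : suc j ≤ m
      1+j≤m = subst (_≤ m) (+-comm j 1) (+-monoˡ-≤ 1 (≤-trans (n/p≤p*n/[1+p] p n 2≤p) (m≤m+n _ p)))

      upper : a ≤ b + c + u
      upper = m+n≤o+q⇒m≤o+[q∸n] a (S⁺ m) (b + c) (Sc m)
        (subst (a + S⁺ m ≤_) (sym (+-assoc b c (Sc m)))
          (S⁺-upperBound (≤-trans 1<n (m≤n*m n p)) (addPrimes n)
            (λ {B} aB p*∂B≡p*n → addPrimes⁺ aB (*-cancelˡ-≡ (∂ B) n p p*∂B≡p*n))))

      lower : b + c ≤ a + v
      lower = subst (_≤ a + v) (+-comm c b) (S⁺[pn]-lowerBound 1<n)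

      small : suc k * v ≤ S⁺ m
      small = begin
        suc k * (S□ p * (S□ p * S⁺ j))  ≡⟨ cong (suc k *_) (*-assoc (S□ p) (S□ p) (S⁺ j)) ⟨
        suc k * (S□ p * S□ p * S⁺ j)    ≡⟨ *-assoc (suc k) (S□ p * S□ p) (S⁺ j) ⟨
        suc k * (S□ p * S□ p) * S⁺ j    ≤⟨ *-monoʳ-≤ (suc k * (S□ p * S□ p)) (S⁺≤Sc j) ⟩
        suc k * (S□ p * S□ p) * Sc j    ≤⟨ negligible ⟩
        S⁺ (suc j)                      ≤⟨ nondecreasing (suc j) (n≤1+n j) m 1+j≤m ⟩
        S⁺ m                            ∎

    S⁺[pn]-estimate : Monotonic → AxiomG₁⁺ → ∀ k →
      Eventually (λ n → suc k * ∣ S⁺ (p * n) ⊖ (S□ (p * n) + S□ p * S⁺ n) ∣ ≤ S⁺ (encodingDegree (p * n)))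
    S⁺[pn]-estimate monotonic G₁⁺ k =
      eventually-map (λ {n} (2≤j , negligible , excess , nondecreasing) →
                        S⁺[pn]-estimate-at k n 2≤j negligible excess nondecreasing)
        (eventually-/ p
          (eventually-∧ (eventually-≥ 2)
          (eventually-∧ (G₁⁺⇒Sc≤S⁺-suc G₁⁺ (suc k * (S□ p * S□ p)))
          (eventually-∧ (eventually-upwards (G₁⁺⇒Sc∸S⁺≤ G₁⁺ (suc k)))
                        (eventually-upwards (eventually-nondecreasing S⁺ monotonic))))))

open import Data.Integer using (ℤ; +_; _-_; ∣_∣)

corollary3p17 : (𝕊 : ArithSemiring) → ArithSemiring.Monotonic 𝕊 →
    (p : ℕ) → .{{_ : NonZero p}} → ArithSemiring.IsLeastMulDegree 𝕊 p →
    let open ArithSemiring 𝕊 in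
    (∃ λ N → ∀ n → n ≥ N →
       S⁺ n ≤ S□ n + (S□ p * Sc (n / p) + Sc (n / suc p + p + 1)))
    ×
    (AxiomG₁⁺ → ∀ k → ∃ λ N → ∀ n → n ≥ N →
       suc k * ∣ ((+ S⁺ (p * n)) - (+ S□ (p * n))) - (+ (S□ p * S⁺ n)) ∣
         ≤ S⁺ ((p * n) / suc p + p + 1))
corollary3p17 𝕊 monotonic p least =
  (2 , λ _ → S⁺-bound) ,
  λ G₁⁺ k → eventually-map (λ {n} → ≤-trans (≤-reflexive (cong (λ i → suc k * ∣ i ∣)
                             ([m-n]-o≡m⊖[n+o] (S⁺ (p * n)) (S□ (p * n)) (S□ p * S⁺ n)))))
                           (S⁺[pn]-estimate monotonic G₁⁺ k)
  where
  open ArithSemiring 𝕊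
  open Semiring 𝕊
  open LeastMulDegree p least
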